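{- Let $\alpha=(\alpha_1,\dots,\alpha_n)$ be a weak composition. The Kohnert poset $\mathcal{P}(\mathrm{Lock}(\alpha))$ is bounded (has a unique minimal element) if and only if the nonzero entries of $\alpha$ occurring after the first $0$ entry are weakly increasing (from left to right).
   Context: A diagram is a finite subset of $\mathbb{N}\times\mathbb{N}$; $(r,c)$ is a cell in row $r$, column $c$, rows numbered bottom to top. For $\alpha$ with $m=\max_i\alpha_i$, the lock diagram $\mathrm{Lock}(\alpha)$ has exactly $\alpha_i$ cells in row $i$, occupying columns $m-\alpha_i+1,\dots,m$. A Kohnert move on $D$ takes the rightmost cell $(r,c)$ of some row and moves it to $(r',c)$, $r'$ the largest $1\le r'<r$ with $(r',c)\notin D$ (no move if none). $\mathcal{P}(D)$ is the set of diagrams obtainable from $D$ by finitely many Kohnert moves (including $D$), ordered by the transitive closure of $D_2<D_1$ when $D_2$ results from $D_1$ by one Kohnert move; $D$ is its unique maximal element. -}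

module Defs where

open import Data.Nat using (ℕ; zero; suc; _+_; _∸_; _≤_; _<_; _≤ᵇ_; _<ᵇ_; _⊔_)
open import Data.Nat.Properties using (_≟_)
open import Data.Bool using (Bool; true; false; _∧_; if_then_else_)
open import Data.List using (List; []; _∷_)
open import Data.Product using (Σ; _×_; _,_; ∃)
open import Relation.Nullary using (¬_; yes; no)
open import Relation.Binary.PropositionalEquality using (_≡_)
open import Relation.Binary.Construct.Closure.ReflexiveTransitive using (Star)
open import Relation.Binary.Construct.Closure.Transitive using (TransClosure)
open import Data.List.Relation.Unary.Linked using (Linked)

-- A diagram: membership predicate on cells (row r, column c); rows and
-- columns are numbered from 1 (row 1 = bottom).  Diagrams are compared
-- extensionally (same set of cells).
Diagram : Set
Diagram = ℕ → ℕ → Bool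

_≐_ : Diagram → Diagram → Set
D ≐ E = ∀ r c → D r c ≡ E r c

-- weak compositions as lists; entry i (1-indexed), 0 outside range
entry : List ℕ → ℕ → ℕ
entry α zero = 0
entry [] (suc i) = 0
entry (a ∷ α) (suc zero) = a
entry (a ∷ α) (suc (suc i)) = entry α (suc i)

maxEntry : List ℕ → ℕ
maxEntry [] = 0
maxEntry (a ∷ α) = a ⊔ maxEntry α

-- Lock(α): row i has α_i cells in columns m-α_i+1,...,m
Lock : List ℕ → Diagram
Lock α r c = (1 ≤ᵇ r) ∧ (1 ≤ᵇ c) ∧ (c ≤ᵇ m) ∧ (m <ᵇ c + entry α r)
  where m = maxEntry α

Rightmost : Diagram → ℕ → ℕ → Set
Rightmost D r c = (D r c ≡ true) × (∀ c' → c < c' → D r c' ≡ false)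

Target : Diagram → ℕ → ℕ → ℕ → Set
Target D r c r' = (1 ≤ r') × (r' < r) × (D r' c ≡ false)
                × (∀ s → r' < s → s < r → D s c ≡ true)

moveCell : Diagram → ℕ → ℕ → ℕ → Diagram
moveCell D r c r' s d with s ≟ r | s ≟ r' | d ≟ c
... | yes _ | _     | yes _ = false
... | _     | yes _ | yes _ = true
... | _     | _     | _     = D s d

KohnertMove : Diagram → Diagram → Set
KohnertMove D E = Σ ℕ λ r → Σ ℕ λ c → Σ ℕ λ r' →
  Rightmost D r c × Target D r c r' × (E ≐ moveCell D r c r')

InP : Diagram → Diagram → Set
InP D E = Σ Diagram λ F → Star KohnertMove D F × (F ≐ E)

_<K_ : Diagram → Diagram → Set
E <K F = TransClosure KohnertMove F E

IsMinimal : Diagram → Diagram → Set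
IsMinimal D E = InP D E × (∀ F → InP D F → ¬ (F <K E))

HasUniqueMinimal : Diagram → Set
HasUniqueMinimal D = Σ Diagram λ E → IsMinimal D E × (∀ E' → IsMinimal D E' → E' ≐ E)

afterFirstZero : List ℕ → List ℕ
afterFirstZero [] = []
afterFirstZero (zero ∷ α) = α
afterFirstZero (suc _ ∷ α) = afterFirstZero α

nonzeros : List ℕ → List ℕ
nonzeros [] = []
nonzeros (zero ∷ α) = nonzeros α
nonzeros (suc a ∷ α) = suc a ∷ nonzeros α

LockCondition : List ℕ → Set
LockCondition α = Linked _≤_ (nonzeros (afterFirstZero α))

-- A Kohnert move sends the rightmost cell of a row straight down, so in a lock
-- diagram a whole row of length b slides, cell by cell, into an empty row below it whenever
-- every row in between has length at least b.  Sliding nonzero rows into the zero rows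
-- therefore reaches Lock (pack α), where pack α lists the nonzero entries of α and then its
-- zeros; in a packed lock diagram every row below a nonempty row reaches the last column, so
-- no move is possible and Lock (pack α) is minimal.
--
-- If the nonzero entries after the first zero (at row z) are weakly increasing, every diagram
-- in P(Lock α) satisfies an invariant: rows below z never change, every column keeps its number
-- of cells in rows ≥ z, and above any height the last column has at most as many cells as any
-- other column that already has a cell below that height.  A diagram satisfying the invariant
-- and admitting no move is determined by it, so Lock (pack α) is the unique minimal element.
--
-- Otherwise there is a descent b < a after the first zero.  Sliding b down next to a, then a
-- zero up to just below a, and then b into that zero row, gives another composition whose
-- packing has b where pack α has a; both packed lock diagrams are minimal.

module Submission where

open import Defs
open import Data.Nat
open import Data.Nat.Properties
open import Data.Bool using (Bool; true; false; _∧_)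
open import Data.Bool.Properties using (T-≡; ⇔→≡)
open import Data.Empty using (⊥; ⊥-elim)
open import Data.Product using (Σ; ∃-syntax; _×_; _,_; proj₁; proj₂)
open import Data.Sum using (_⊎_; inj₁; inj₂)
open import Data.List using (List; []; _∷_; _++_; length; replicate; [_])
open import Data.List.Properties using (++-assoc; ++-identityʳ)
open import Data.List.Relation.Unary.All using (All; []; _∷_)
open import Data.List.Relation.Unary.AllPairs using (AllPairs; []; _∷_)
open import Data.List.Relation.Unary.Linked using (Linked; []; [-]; _∷_; linked?)
open import Data.List.Relation.Unary.Linked.Properties using (Linked⇒AllPairs)
open import Function.Base using (_∘_; _$_; case_of_; flip)
open import Function.Bundles using (_⇔_; mk⇔; Equivalence)
open import Relation.Nullary using (¬_; yes; no; contradiction)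
open import Relation.Binary.Definitions using (tri<; tri≈; tri>)
open import Data.Nat.Tactic.RingSolver using (solve-∀)
open import Relation.Binary.PropositionalEquality hiding ([_])
open import Relation.Binary.Construct.Closure.ReflexiveTransitive using (Star; ε; _◅_; _◅◅_)
open import Relation.Binary.Construct.Closure.Transitive as Plus using (TransClosure)

-- Lock diagrams

≤⇒≤ᵇ≡true : ∀ {m n} → m ≤ n → (m ≤ᵇ n) ≡ true
≤⇒≤ᵇ≡true = Equivalence.to T-≡ ∘ ≤⇒≤ᵇ

≤ᵇ≡true⇒≤ : ∀ {m n} → (m ≤ᵇ n) ≡ true → m ≤ n
≤ᵇ≡true⇒≤ = ≤ᵇ⇒≤ _ _ ∘ Equivalence.from T-≡

<⇒<ᵇ≡true : ∀ {m n} → m < n → (m <ᵇ n) ≡ true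
<⇒<ᵇ≡true = Equivalence.to T-≡ ∘ <⇒<ᵇ

<ᵇ≡true⇒< : ∀ {m n} → (m <ᵇ n) ≡ true → m < n
<ᵇ≡true⇒< = <ᵇ⇒< _ _ ∘ Equivalence.from T-≡

∧≡true : ∀ {x y} → x ∧ y ≡ true → x ≡ true × y ≡ true
∧≡true {true} {true} _ = refl , refl

true≢false : ∀ {b} → b ≡ true → b ≡ false → ⊥
true≢false refl ()

¬true⇒false : ∀ {b} → ¬ b ≡ true → b ≡ false
¬true⇒false {false} _ = refl
¬true⇒false {true} b≢true = contradiction refl b≢true

≡true-ext : ∀ {x y} → (x ≡ true → y ≡ true) → (y ≡ true → x ≡ true) → x ≡ y
≡true-ext x⇒y y⇒x = ⇔→≡ (mk⇔ x⇒y y⇒x)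

∸<⇔<+ : ∀ {m b c} → b ≤ m → (m ∸ b < c) ⇔ (m < c + b)
∸<⇔<+ {m} {b} {c} b≤m = mk⇔
  (λ m∸b<c → subst (_< c + b) (m∸n+n≡m b≤m) (+-monoˡ-< b m∸b<c))
  (λ m<c+b → ≰⇒> (λ c≤m∸b → <⇒≱ m<c+b
     (subst (c + b ≤_) (m∸n+n≡m b≤m) (+-monoˡ-≤ b c≤m∸b))))

lockDiagram : ℕ → (ℕ → ℕ) → Diagram
lockDiagram m f r c = (1 ≤ᵇ r) ∧ (1 ≤ᵇ c) ∧ (c ≤ᵇ m) ∧ (m <ᵇ c + f r)

InLock : ℕ → (ℕ → ℕ) → ℕ → ℕ → Set
InLock m f r c = (1 ≤ r) × (1 ≤ c) × (c ≤ m) × (m < c + f r)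

lock-intro : ∀ {m} f {r c} → InLock m f r c → lockDiagram m f r c ≡ true
lock-intro f (1≤r , 1≤c , c≤m , m<c+fr)
  rewrite ≤⇒≤ᵇ≡true 1≤r | ≤⇒≤ᵇ≡true 1≤c | ≤⇒≤ᵇ≡true c≤m | <⇒<ᵇ≡true m<c+fr = refl

lock-elim : ∀ {m} f r c → lockDiagram m f r c ≡ true → InLock m f r c
lock-elim {m} f r c cell with ∧≡true {1 ≤ᵇ r} cell
... | 1≤r , rest with ∧≡true {1 ≤ᵇ c} rest
... | 1≤c , rest′ with ∧≡true {c ≤ᵇ m} rest′
... | c≤m , m<c+fr = ≤ᵇ≡true⇒≤ 1≤r , ≤ᵇ≡true⇒≤ 1≤c , ≤ᵇ≡true⇒≤ c≤m , <ᵇ≡true⇒< m<c+fr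

-- opaque, so that unification never tries to invert it
opaque
  between : ℕ → ℕ → ℕ → Bool
  between lo hi c = (lo <ᵇ c) ∧ (c ≤ᵇ hi)

  between-intro : ∀ {lo hi c} → lo < c → c ≤ hi → between lo hi c ≡ true
  between-intro lo<c c≤hi rewrite <⇒<ᵇ≡true lo<c | ≤⇒≤ᵇ≡true c≤hi = refl

  between-elim : ∀ {lo hi c} → between lo hi c ≡ true → lo < c × c ≤ hi
  between-elim {lo} {hi} {c} cell with ∧≡true {lo <ᵇ c} cell
  ... | lo<c , c≤hi = <ᵇ≡true⇒< lo<c , ≤ᵇ≡true⇒≤ c≤hi

between-outside : ∀ {lo hi c} → ¬ (lo < c × c ≤ hi) → between lo hi c ≡ false
between-outside ¬cell = ¬true⇒false (¬cell ∘ between-elim)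

between-empty : ∀ lo c → between lo lo c ≡ false
between-empty lo c = between-outside λ (lo<c , c≤lo) → <⇒≱ lo<c c≤lo

between-shrinkʳ : ∀ {lo hi c} → c ≢ suc hi → between lo (suc hi) c ≡ between lo hi c
between-shrinkʳ {lo} {hi} {c} c≢1+hi = ≡true-ext
  (λ cell → let lo<c , c≤1+hi = between-elim cell in
     between-intro lo<c (≤-pred (≤∧≢⇒< c≤1+hi c≢1+hi)))
  (λ cell → let lo<c , c≤hi = between-elim cell in between-intro lo<c (m≤n⇒m≤1+n c≤hi))

between-growˡ : ∀ {lo hi c} → c ≢ suc lo → between (suc lo) hi c ≡ between lo hi c
between-growˡ {lo} {hi} {c} c≢1+lo = ≡true-ext
  (λ cell → let 1+lo<c , c≤hi = between-elim cell in between-intro (<-trans (n<1+n lo) 1+lo<c) c≤hi)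
  (λ cell → let lo<c , c≤hi = between-elim cell in
     between-intro (≤∧≢⇒< lo<c (c≢1+lo ∘ sym)) c≤hi)

lock-row : ∀ {m} f {s c} → 1 ≤ s → f s ≤ m → lockDiagram m f s c ≡ between (m ∸ f s) m c
lock-row {m} f {s} {c} 1≤s fs≤m = ≡true-ext
  (λ cell → let _ , _ , c≤m , m<c+fs = lock-elim f s c cell in
     between-intro (Equivalence.from (∸<⇔<+ fs≤m) m<c+fs) c≤m)
  (λ cell → let m∸fs<c , c≤m = between-elim cell in
     lock-intro f (1≤s , ≤-trans (s≤s z≤n) m∸fs<c , c≤m , Equivalence.to (∸<⇔<+ fs≤m) m∸fs<c))

lock-row-cong : ∀ {m} f g {s c} → f s ≡ g s → lockDiagram m f s c ≡ lockDiagram m g s c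
lock-row-cong {m} f g {s} {c} fs≡gs = cong (λ l → (1 ≤ᵇ s) ∧ (1 ≤ᵇ c) ∧ (c ≤ᵇ m) ∧ (m <ᵇ c + l)) fs≡gs

-- Kohnert moves and reachability

moveCell-source : ∀ D r c r' → moveCell D r c r' r c ≡ false
moveCell-source D r c r' with r ≟ r | r ≟ r' | c ≟ c
... | yes _ | _ | yes _ = refl
... | no r≢r | _ | _ = contradiction refl r≢r
... | yes _ | _ | no c≢c = contradiction refl c≢c

moveCell-target : ∀ D r c r' → r' ≢ r → moveCell D r c r' r' c ≡ true
moveCell-target D r c r' r'≢r with r' ≟ r | r' ≟ r' | c ≟ c
... | yes r'≡r | _ | _ = contradiction r'≡r r'≢r
... | no _ | yes _ | yes _ = refl
... | no _ | no r'≢r' | _ = contradiction refl r'≢r'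
... | no _ | yes _ | no c≢c = contradiction refl c≢c

moveCell-otherColumn : ∀ D r c r' s d → d ≢ c → moveCell D r c r' s d ≡ D s d
moveCell-otherColumn D r c r' s d d≢c with s ≟ r | s ≟ r' | d ≟ c
... | _ | _ | yes d≡c = contradiction d≡c d≢c
... | yes _ | yes _ | no _ = refl
... | yes _ | no _ | no _ = refl
... | no _ | yes _ | no _ = refl
... | no _ | no _ | no _ = refl

moveCell-otherRow : ∀ D r c r' s d → s ≢ r → s ≢ r' → moveCell D r c r' s d ≡ D s d
moveCell-otherRow D r c r' s d s≢r s≢r' with s ≟ r | s ≟ r' | d ≟ c
... | yes s≡r | _ | _ = contradiction s≡r s≢r
... | no _ | yes s≡r' | _ = contradiction s≡r' s≢r'
... | no _ | no _ | yes _ = refl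
... | no _ | no _ | no _ = refl

moveCell-true : ∀ D r c r' s d → moveCell D r c r' s d ≡ true → (s ≡ r' × d ≡ c) ⊎ D s d ≡ true
moveCell-true D r c r' s d cell with s ≟ r | s ≟ r' | d ≟ c
moveCell-true D r c r' s d () | yes _ | _ | yes _
... | no _ | yes s≡r' | yes d≡c = inj₁ (s≡r' , d≡c)
... | yes _ | yes _ | no _ = inj₂ cell
... | yes _ | no _ | no _ = inj₂ cell
... | no _ | yes _ | no _ = inj₂ cell
... | no _ | no _ | yes _ = inj₂ cell
... | no _ | no _ | no _ = inj₂ cell

moveCell-cong : ∀ {D D'} r c r' → D ≐ D' → moveCell D r c r' ≐ moveCell D' r c r'
moveCell-cong r c r' D≐D' s d with s ≟ r | s ≟ r' | d ≟ c
... | yes _ | _ | yes _ = refl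
... | no _ | yes _ | yes _ = refl
... | yes _ | yes _ | no _ = D≐D' s d
... | yes _ | no _ | no _ = D≐D' s d
... | no _ | yes _ | no _ = D≐D' s d
... | no _ | no _ | yes _ = D≐D' s d
... | no _ | no _ | no _ = D≐D' s d

by-≟ : ∀ {P : ℕ → Set} d c → P c → (d ≢ c → P d) → P d
by-≟ d c Pc Pother with d ≟ c
... | yes refl = Pc
... | no d≢c = Pother d≢c

≐-refl : ∀ {D} → D ≐ D
≐-refl r c = refl

≐-sym : ∀ {D E} → D ≐ E → E ≐ D
≐-sym D≐E r c = sym (D≐E r c)

≐-trans : ∀ {D E F} → D ≐ E → E ≐ F → D ≐ F
≐-trans D≐E E≐F r c = trans (D≐E r c) (E≐F r c)

KohnertMove-respˡ : ∀ {D D' E} → D ≐ D' → KohnertMove D E → KohnertMove D' E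
KohnertMove-respˡ D≐D' (r , c , r' , (cell , rightmost) , (1≤r' , r'<r , empty , full) , E≐) =
  r , c , r' ,
  (trans (sym (D≐D' r c)) cell , λ c' c<c' → trans (sym (D≐D' r c')) (rightmost c' c<c')) ,
  (1≤r' , r'<r , trans (sym (D≐D' r' c)) empty , λ s r'<s s<r → trans (sym (D≐D' s c)) (full s r'<s s<r)) ,
  ≐-trans E≐ (moveCell-cong r c r' D≐D')

Star-respˡ : ∀ {D D' E} → D ≐ D' → Star KohnertMove D E → InP D' E
Star-respˡ D≐D' ε = _ , ε , ≐-sym D≐D'
Star-respˡ D≐D' (move ◅ moves) with Star-respˡ ≐-refl moves
... | F , moves' , F≐E = F , KohnertMove-respˡ D≐D' move ◅ moves' , F≐E

InP-refl : ∀ D → InP D D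
InP-refl D = D , ε , ≐-refl

InP-respʳ : ∀ {D E E'} → InP D E → E ≐ E' → InP D E'
InP-respʳ (F , moves , F≐E) E≐E' = F , moves , ≐-trans F≐E E≐E'

InP-respˡ : ∀ {D D' E} → D ≐ D' → InP D E → InP D' E
InP-respˡ D≐D' (F , moves , F≐E) = InP-respʳ (Star-respˡ D≐D' moves) F≐E

InP-trans : ∀ {D E F} → InP D E → InP E F → InP D F
InP-trans (G , moves , G≐E) E↠F with InP-respˡ (≐-sym G≐E) E↠F
... | H , moves' , H≐F = H , moves ◅◅ moves' , H≐F

InP-step : ∀ {D E F} → InP D E → KohnertMove E F → InP D F
InP-step D↠E move = InP-trans D↠E (_ , move ◅ ε , ≐-refl)

-- Sliding a row down

∸≡suc[∸suc] : ∀ {m t} → t < m → m ∸ t ≡ suc (m ∸ suc t)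
∸≡suc[∸suc] {suc m} {zero} _ = refl
∸≡suc[∸suc] {suc m} {suc t} (s≤s t<m) = ∸≡suc[∸suc] t<m

-- Row r of a lock diagram slides down into the empty row q, one cell per Kohnert move,
-- rightmost cell first; every row strictly between is at least as long, so it fills
-- the column that each moving cell passes through.
module RowDrop (m : ℕ) (f g : ℕ → ℕ) {q r : ℕ} (1≤q : 1 ≤ q) (q<r : q < r)
  (fq≡0 : f q ≡ 0) (fr≤m : f r ≤ m) (rows-between : ∀ s → q < s → s < r → f r ≤ f s)
  (gq≡fr : g q ≡ f r) (gr≡0 : g r ≡ 0) (g≡f : ∀ s → s ≢ q → s ≢ r → g s ≡ f s) where

  private
    b : ℕ
    b = f r

    1≤r : 1 ≤ r
    1≤r = ≤-trans 1≤q (<⇒≤ q<r)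

    q≢r : q ≢ r
    q≢r = <⇒≢ q<r

  -- after t moves, the cells of row r in columns m-t+1 … m are in row q
  stage : ℕ → Diagram
  stage t s c with s ≟ r | s ≟ q
  ... | yes _ | _ = between (m ∸ b) (m ∸ t) c
  ... | no _ | yes _ = between (m ∸ t) m c
  ... | no _ | no _ = lockDiagram m f s c

  stage-r : ∀ t c → stage t r c ≡ between (m ∸ b) (m ∸ t) c
  stage-r t c with r ≟ r
  ... | yes _ = refl
  ... | no r≢r = contradiction refl r≢r

  stage-q : ∀ t c → stage t q c ≡ between (m ∸ t) m c
  stage-q t c with q ≟ r | q ≟ q
  ... | yes q≡r | _ = contradiction q≡r q≢r
  ... | no _ | yes _ = refl
  ... | no _ | no q≢q = contradiction refl q≢q

  stage-other : ∀ t s c → s ≢ r → s ≢ q → stage t s c ≡ lockDiagram m f s c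
  stage-other t s c s≢r s≢q with s ≟ r | s ≟ q
  ... | yes s≡r | _ = contradiction s≡r s≢r
  ... | no _ | yes s≡q = contradiction s≡q s≢q
  ... | no _ | no _ = refl

  by-row : ∀ {P : ℕ → Set} s → P r → P q → (s ≢ r → s ≢ q → P s) → P s
  by-row s Pr Pq Pother with s ≟ r | s ≟ q
  ... | yes refl | _ = Pr
  ... | no _ | yes refl = Pq
  ... | no s≢r | no s≢q = Pother s≢r s≢q

  stage-initial : stage 0 ≐ lockDiagram m f
  stage-initial s c = by-row {λ s → stage 0 s c ≡ lockDiagram m f s c} s
    (trans (stage-r 0 c) (sym (lock-row f 1≤r fr≤m)))
    (trans (stage-q 0 c) (sym (trans (lock-row f 1≤q (subst (_≤ m) (sym fq≡0) z≤n))
                                     (cong (λ l → between (m ∸ l) m c) fq≡0))))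
    (stage-other 0 s c)

  stage-final : stage b ≐ lockDiagram m g
  stage-final s c = by-row {λ s → stage b s c ≡ lockDiagram m g s c} s
    (begin
      stage b r c                   ≡⟨ stage-r b c ⟩
      between (m ∸ b) (m ∸ b) c     ≡⟨ between-empty (m ∸ b) c ⟩
      false                         ≡⟨ sym (between-empty m c) ⟩
      between (m ∸ 0) m c           ≡⟨ cong (λ l → between (m ∸ l) m c) (sym gr≡0) ⟩
      between (m ∸ g r) m c         ≡⟨ sym (lock-row g 1≤r (subst (_≤ m) (sym gr≡0) z≤n)) ⟩
      lockDiagram m g r c           ∎)
    (begin
      stage b q c                   ≡⟨ stage-q b c ⟩
      between (m ∸ b) m c           ≡⟨ cong (λ l → between (m ∸ l) m c) (sym gq≡fr) ⟩
      between (m ∸ g q) m c         ≡⟨ sym (lock-row g 1≤q (subst (_≤ m) (sym gq≡fr) fr≤m)) ⟩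
      lockDiagram m g q c           ∎)
    (λ s≢r s≢q → trans (stage-other b s c s≢r s≢q) (lock-row-cong {m} f g {s} {c} (sym (g≡f s s≢q s≢r))))
    where open ≡-Reasoning

  module Step (t : ℕ) (t<b : t < b) where

    private
      t<m : t < m
      t<m = <-≤-trans t<b fr≤m

      c₀ : ℕ
      c₀ = m ∸ t

      c₀≡suc : c₀ ≡ suc (m ∸ suc t)
      c₀≡suc = ∸≡suc[∸suc] t<m

      c₀+t≡m : c₀ + t ≡ m
      c₀+t≡m = m∸n+n≡m (<⇒≤ t<m)

    rightmost : Rightmost (stage t) r c₀
    rightmost = trans (stage-r t c₀) (between-intro (∸-monoʳ-< t<b fr≤m) ≤-refl)
              , λ c' c₀<c' → trans (stage-r t c') (between-outside λ (_ , c'≤c₀) → <⇒≱ c₀<c' c'≤c₀)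

    target : Target (stage t) r c₀ q
    target = 1≤q , q<r
           , trans (stage-q t c₀) (between-outside λ (c₀<c₀ , _) → <-irrefl refl c₀<c₀)
           , λ s q<s s<r → trans (stage-other t s c₀ (<⇒≢ s<r) (<⇒≢ q<s ∘ sym))
               (lock-intro f (≤-trans 1≤q (<⇒≤ q<s) , m<n⇒0<n∸m t<m , m∸n≤m m t ,
                 subst (_< c₀ + f s) c₀+t≡m (+-monoʳ-< c₀ (<-≤-trans t<b (rows-between s q<s s<r)))))

    row-r : ∀ d → stage (suc t) r d ≡ moveCell (stage t) r c₀ q r d
    row-r d = by-≟ {λ d → stage (suc t) r d ≡ moveCell (stage t) r c₀ q r d} d c₀
      (begin
        stage (suc t) r c₀                      ≡⟨ stage-r (suc t) c₀ ⟩
        between (m ∸ b) (m ∸ suc t) c₀          ≡⟨ between-outside (λ (_ , c₀≤) → <⇒≱ (≤-reflexive (sym c₀≡suc)) c₀≤) ⟩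
        false                                   ≡⟨ sym (moveCell-source (stage t) r c₀ q) ⟩
        moveCell (stage t) r c₀ q r c₀          ∎)
      (λ d≢c₀ → begin
        stage (suc t) r d                       ≡⟨ stage-r (suc t) d ⟩
        between (m ∸ b) (m ∸ suc t) d           ≡⟨ sym (between-shrinkʳ (λ d≡ → d≢c₀ (trans d≡ (sym c₀≡suc)))) ⟩
        between (m ∸ b) (suc (m ∸ suc t)) d     ≡⟨ cong (λ hi → between (m ∸ b) hi d) (sym c₀≡suc) ⟩
        between (m ∸ b) c₀ d                    ≡⟨ sym (stage-r t d) ⟩
        stage t r d                             ≡⟨ sym (moveCell-otherColumn (stage t) r c₀ q r d d≢c₀) ⟩
        moveCell (stage t) r c₀ q r d           ∎)
      where open ≡-Reasoning

    row-q : ∀ d → stage (suc t) q d ≡ moveCell (stage t) r c₀ q q d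
    row-q d = by-≟ {λ d → stage (suc t) q d ≡ moveCell (stage t) r c₀ q q d} d c₀
      (begin
        stage (suc t) q c₀                      ≡⟨ stage-q (suc t) c₀ ⟩
        between (m ∸ suc t) m c₀                ≡⟨ between-intro (≤-reflexive (sym c₀≡suc)) (m∸n≤m m t) ⟩
        true                                    ≡⟨ sym (moveCell-target (stage t) r c₀ q q≢r) ⟩
        moveCell (stage t) r c₀ q q c₀          ∎)
      (λ d≢c₀ → begin
        stage (suc t) q d                       ≡⟨ stage-q (suc t) d ⟩
        between (m ∸ suc t) m d                 ≡⟨ sym (between-growˡ (λ d≡ → d≢c₀ (trans d≡ (sym c₀≡suc)))) ⟩
        between (suc (m ∸ suc t)) m d           ≡⟨ cong (λ lo → between lo m d) (sym c₀≡suc) ⟩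
        between c₀ m d                          ≡⟨ sym (stage-q t d) ⟩
        stage t q d                             ≡⟨ sym (moveCell-otherColumn (stage t) r c₀ q q d d≢c₀) ⟩
        moveCell (stage t) r c₀ q q d           ∎)
      where open ≡-Reasoning

    move : KohnertMove (stage t) (stage (suc t))
    move = r , c₀ , q , rightmost , target , λ s d →
      by-row {λ s → stage (suc t) s d ≡ moveCell (stage t) r c₀ q s d} s (row-r d) (row-q d)
        λ s≢r s≢q → trans (stage-other (suc t) s d s≢r s≢q)
                          (sym (trans (moveCell-otherRow (stage t) r c₀ q s d s≢r s≢q) (stage-other t s d s≢r s≢q)))

  stage-reachable : ∀ t → t ≤ b → InP (stage 0) (stage t)
  stage-reachable zero _ = InP-refl _
  stage-reachable (suc t) t<b = InP-step (stage-reachable t (<⇒≤ t<b)) (Step.move t t<b)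

  drop : InP (lockDiagram m f) (lockDiagram m g)
  drop = InP-respʳ (InP-respˡ stage-initial (stage-reachable b ≤-refl)) stage-final

-- Rearranging compositions

entry-++ʳ : ∀ X L i → entry (X ++ L) (suc (length X + i)) ≡ entry L (suc i)
entry-++ʳ [] L i = refl
entry-++ʳ (x ∷ X) L i = entry-++ʳ X L i

entry-++ˡ : ∀ X A B s → s ≤ length X → entry (X ++ A) s ≡ entry (X ++ B) s
entry-++ˡ X A B zero _ = refl
entry-++ˡ (x ∷ X) A B (suc zero) _ = refl
entry-++ˡ (x ∷ X) A B (suc (suc s)) (s≤s s≤∣X∣) = entry-++ˡ X A B (suc s) s≤∣X∣

entry≤maxEntry : ∀ α s → entry α s ≤ maxEntry α
entry≤maxEntry α zero = z≤n
entry≤maxEntry [] (suc s) = z≤n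
entry≤maxEntry (a ∷ α) (suc zero) = m≤m⊔n a _
entry≤maxEntry (a ∷ α) (suc (suc s)) = ≤-trans (entry≤maxEntry α (suc s)) (m≤n⊔m a _)

maxEntry-++-cong : ∀ X {A B} → maxEntry A ≡ maxEntry B → maxEntry (X ++ A) ≡ maxEntry (X ++ B)
maxEntry-++-cong [] eq = eq
maxEntry-++-cong (x ∷ X) eq = cong (x ⊔_) (maxEntry-++-cong X eq)

_↝_ : List ℕ → List ℕ → Set
α ↝ β = maxEntry α ≡ maxEntry β × InP (Lock α) (Lock β)

↝-refl : ∀ α → α ↝ α
↝-refl α = refl , InP-refl _

↝-trans : ∀ {α β γ} → α ↝ β → β ↝ γ → α ↝ γ
↝-trans (eq₁ , reach₁) (eq₂ , reach₂) = trans eq₁ eq₂ , InP-trans reach₁ reach₂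

-- RowDrop for compositions with a common prefix X; q and r are positions inside the suffix
↝-drop : ∀ X A B q r → maxEntry A ≡ maxEntry B → 1 ≤ q → q < r → entry A q ≡ 0 →
  (∀ s → q < s → s < r → entry A r ≤ entry A s) → entry B q ≡ entry A r → entry B r ≡ 0 →
  (∀ s → s ≢ q → s ≢ r → entry B s ≡ entry A s) → (X ++ A) ↝ (X ++ B)
↝-drop X A B (suc q) (suc r) max≡ _ q<r Aq≡0 rows-between Bq≡Ar Br≡0 B≡A =
  width≡ , subst (λ w → InP (Lock (X ++ A)) (lockDiagram w (entry (X ++ B)))) width≡ dropped
  where
  ℓ = length X
  width≡ = maxEntry-++-cong X max≡

  beyond-prefix : ∀ {P : ℕ → Set} s → ℓ < s → (∀ i → P (suc (ℓ + i))) → P s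
  beyond-prefix {P} s ℓ<s P-shifted = subst P (m+[n∸m]≡n ℓ<s) (P-shifted (s ∸ suc ℓ))

  rows-between-shifted : ∀ s → suc (ℓ + q) < s → s < suc (ℓ + r) →
                    entry (X ++ A) (suc (ℓ + r)) ≤ entry (X ++ A) s
  rows-between-shifted s q'<s = beyond-prefix
    {λ s → suc (ℓ + q) < s → s < suc (ℓ + r) → entry (X ++ A) (suc (ℓ + r)) ≤ entry (X ++ A) s}
    s (<-trans (s≤s (m≤m+n ℓ q)) q'<s)
    (λ i q'<i' i'<r' → subst₂ _≤_ (sym (entry-++ʳ X A r)) (sym (entry-++ʳ X A i))
       (rows-between (suc i) (s≤s (+-cancelˡ-< ℓ q i (≤-pred q'<i'))) (s≤s (+-cancelˡ-< ℓ i r (≤-pred i'<r')))))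
    q'<s

  others-shifted : ∀ s → s ≢ suc (ℓ + q) → s ≢ suc (ℓ + r) → entry (X ++ B) s ≡ entry (X ++ A) s
  others-shifted s s≢q s≢r with s ≤? ℓ
  ... | yes s≤ℓ = entry-++ˡ X B A s s≤ℓ
  ... | no s≰ℓ = beyond-prefix {λ s → s ≢ suc (ℓ + q) → s ≢ suc (ℓ + r) → entry (X ++ B) s ≡ entry (X ++ A) s}
        s (≰⇒> s≰ℓ)
        (λ i s≢q s≢r → trans (entry-++ʳ X B i) (trans (B≡A (suc i) (s≢q ∘ cong (suc ∘ (ℓ +_)) ∘ suc-injective) (s≢r ∘ cong (suc ∘ (ℓ +_)) ∘ suc-injective))
                                                       (sym (entry-++ʳ X A i))))
        s≢q s≢r

  dropped : InP (Lock (X ++ A)) (lockDiagram (maxEntry (X ++ A)) (entry (X ++ B)))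
  dropped = RowDrop.drop (maxEntry (X ++ A)) (entry (X ++ A)) (entry (X ++ B))
    (s≤s z≤n) (s≤s (+-monoʳ-< ℓ (≤-pred q<r)))
    (trans (entry-++ʳ X A q) Aq≡0)
    (entry≤maxEntry (X ++ A) (suc (ℓ + r)))
    rows-between-shifted
    (trans (entry-++ʳ X B q) (trans Bq≡Ar (sym (entry-++ʳ X A r))))
    (trans (entry-++ʳ X B r) Br≡0)
    others-shifted

↝-sink : ∀ X y Y → (X ++ 0 ∷ y ∷ Y) ↝ (X ++ y ∷ 0 ∷ Y)
↝-sink X y Y = ↝-drop X (0 ∷ y ∷ Y) (y ∷ 0 ∷ Y) 1 2 refl ≤-refl ≤-refl refl
  (λ s 1<s s<2 → contradiction (≤-pred s<2) (<⇒≱ 1<s)) refl refl others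
  where
  others : ∀ s → s ≢ 1 → s ≢ 2 → entry (y ∷ 0 ∷ Y) s ≡ entry (0 ∷ y ∷ Y) s
  others zero _ _ = refl
  others 1 s≢1 _ = contradiction refl s≢1
  others 2 _ s≢2 = contradiction refl s≢2
  others (suc (suc (suc s))) _ _ = refl

-- row a lies between b and the empty row, so it must be at least as long as b
↝-sink-past : ∀ X a b Y → b ≤ a → (X ++ 0 ∷ a ∷ b ∷ Y) ↝ (X ++ b ∷ a ∷ 0 ∷ Y)
↝-sink-past X a b Y b≤a = ↝-drop X (0 ∷ a ∷ b ∷ Y) (b ∷ a ∷ 0 ∷ Y) 1 3 max≡ ≤-refl (s≤s (s≤s z≤n)) refl
  rows-between refl refl others
  where
  max≡ : a ⊔ (b ⊔ maxEntry Y) ≡ b ⊔ (a ⊔ maxEntry Y)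
  max≡ = trans (sym (⊔-assoc a b _)) (trans (cong (_⊔ maxEntry Y) (⊔-comm a b)) (⊔-assoc b a _))
  rows-between : ∀ s → 1 < s → s < 3 → b ≤ entry (0 ∷ a ∷ b ∷ Y) s
  rows-between 1 (s≤s ()) _
  rows-between 2 _ _ = b≤a
  rows-between (suc (suc (suc s))) _ (s≤s (s≤s (s≤s ())))
  others : ∀ s → s ≢ 1 → s ≢ 3 → entry (b ∷ a ∷ 0 ∷ Y) s ≡ entry (0 ∷ a ∷ b ∷ Y) s
  others zero _ _ = refl
  others 1 s≢1 _ = contradiction refl s≢1
  others 2 _ _ = refl
  others 3 _ s≢3 = contradiction refl s≢3
  others (suc (suc (suc (suc s)))) _ _ = refl

↝-sink-block : ∀ X N Y → (X ++ 0 ∷ N ++ Y) ↝ (X ++ N ++ 0 ∷ Y)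
↝-sink-block X [] Y = ↝-refl _
↝-sink-block X (y ∷ N) Y = ↝-trans (↝-sink X y (N ++ Y))
  (subst₂ _↝_ (++-assoc X [ y ] _) (++-assoc X [ y ] _) (↝-sink-block (X ++ [ y ]) N Y))

↝-sink-through-zeros : ∀ X k y Y → (X ++ replicate k 0 ++ y ∷ Y) ↝ (X ++ y ∷ replicate k 0 ++ Y)
↝-sink-through-zeros X zero y Y = ↝-refl _
↝-sink-through-zeros X (suc k) y Y = ↝-trans
  (subst₂ _↝_ (++-assoc X [ 0 ] _) (++-assoc X [ 0 ] _) (↝-sink-through-zeros (X ++ [ 0 ]) k y Y))
  (↝-sink X y (replicate k 0 ++ Y))

zerosOf : List ℕ → List ℕ
zerosOf [] = []
zerosOf (zero ∷ α) = 0 ∷ zerosOf α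
zerosOf (suc _ ∷ α) = zerosOf α

pack : List ℕ → List ℕ
pack α = nonzeros α ++ zerosOf α

↝-pack : ∀ X α → (X ++ α) ↝ (X ++ pack α)
↝-pack X [] = ↝-refl _
↝-pack X (suc a ∷ α) = subst₂ _↝_ (++-assoc X [ suc a ] _) (++-assoc X [ suc a ] _) (↝-pack (X ++ [ suc a ]) α)
↝-pack X (zero ∷ α) = ↝-trans
  (subst₂ _↝_ (++-assoc X [ 0 ] _) (++-assoc X [ 0 ] _) (↝-pack (X ++ [ 0 ]) α))
  (↝-sink-block X (nonzeros α) (zerosOf α))

data Packed : List ℕ → Set where
  zeros : ∀ {α} → All (_≡ 0) α → Packed α
  _∷_ : ∀ a {α} → Packed α → Packed (suc a ∷ α)

packed-pack : ∀ α → Packed (pack α)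
packed-pack α = nonzeros-then-zeros α (zerosOf-zeros α)
  where
  zerosOf-zeros : ∀ α → All (_≡ 0) (zerosOf α)
  zerosOf-zeros [] = []
  zerosOf-zeros (zero ∷ α) = refl ∷ zerosOf-zeros α
  zerosOf-zeros (suc _ ∷ α) = zerosOf-zeros α

  nonzeros-then-zeros : ∀ α {Z} → All (_≡ 0) Z → Packed (nonzeros α ++ Z)
  nonzeros-then-zeros [] Z₀ = zeros Z₀
  nonzeros-then-zeros (zero ∷ α) Z₀ = nonzeros-then-zeros α Z₀
  nonzeros-then-zeros (suc a ∷ α) Z₀ = a ∷ nonzeros-then-zeros α Z₀

entry-zeros : ∀ {α} → All (_≡ 0) α → ∀ s → entry α s ≡ 0
entry-zeros _ zero = refl
entry-zeros [] (suc s) = refl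
entry-zeros (a≡0 ∷ _) 1 = a≡0
entry-zeros (_ ∷ α₀) (suc (suc s)) = entry-zeros α₀ (suc s)

packed-downward : ∀ {γ} → Packed γ → ∀ {s s'} → 1 ≤ s' → s' ≤ s → 1 ≤ entry γ s → 1 ≤ entry γ s'
packed-downward (zeros γ₀) {s} _ _ 1≤γs = contradiction (entry-zeros γ₀ s) (≢-sym (<⇒≢ 1≤γs))
packed-downward (a ∷ γ) {s' = 1} _ _ _ = s≤s z≤n
packed-downward (a ∷ γ) {suc (suc s)} {suc (suc s')} _ (s≤s s'≤s) 1≤γs =
  packed-downward γ (s≤s z≤n) s'≤s 1≤γs

lock-row-nonempty : ∀ {m} f {r c} → InLock m f r c → 1 ≤ f r
lock-row-nonempty f {r} {c} (_ , _ , c≤m , m<c+fr) with f r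
... | zero = contradiction (subst (_ <_) (+-identityʳ c) m<c+fr) (≤⇒≯ c≤m)
... | suc _ = s≤s z≤n

lock-last-column : ∀ {m} f {r} → 1 ≤ r → 1 ≤ m → 1 ≤ f r → lockDiagram m f r m ≡ true
lock-last-column {m} f 1≤r 1≤m 1≤fr =
  lock-intro f (1≤r , 1≤m , ≤-refl , subst (_< m + f _) (+-identityʳ m) (+-monoʳ-< m 1≤fr))

lock-rightmost : ∀ {m} f {r c} → Rightmost (lockDiagram m f) r c → c ≡ m × 1 ≤ r × 1 ≤ m × 1 ≤ f r
lock-rightmost {m} f {r} {c} (cell , nothing-right) with lock-elim f r c cell
... | cell′@(1≤r , 1≤c , c≤m , _) with m≤n⇒m<n∨m≡n c≤m
...   | inj₂ c≡m = c≡m , 1≤r , ≤-trans 1≤c c≤m , lock-row-nonempty f cell′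
...   | inj₁ c<m = contradiction (nothing-right m c<m)
  (true≢false (lock-last-column f 1≤r (≤-trans 1≤c c≤m) (lock-row-nonempty f cell′)))

packed-no-move : ∀ {γ} → Packed γ → ∀ F → ¬ KohnertMove (Lock γ) F
packed-no-move {γ} packed F (r , c , r' , rightmost , (1≤r' , r'<r , empty , _) , _)
  with lock-rightmost {maxEntry γ} (entry γ) {r} {c} rightmost
... | refl , _ , 1≤m , 1≤γr = true≢false
  (lock-last-column (entry γ) 1≤r' 1≤m (packed-downward packed 1≤r' (<⇒≤ r'<r) 1≤γr)) empty

no-move⇒minimal : ∀ {D E} → InP D E → (∀ F → ¬ KohnertMove E F) → IsMinimal D E
no-move⇒minimal D↠E stuck = D↠E , λ F _ E↠⁺F → stuck _ (proj₂ (first-move E↠⁺F))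
  where
  first-move : ∀ {E F} → TransClosure KohnertMove E F → Σ Diagram (KohnertMove E)
  first-move Plus.[ move ] = _ , move
  first-move (move Plus.∷ _) = _ , move

minimal⇒no-move : ∀ {D E} → IsMinimal D E → ∀ F → ¬ KohnertMove E F
minimal⇒no-move (D↠E , minimal) F move = minimal F (InP-step D↠E move) Plus.[ move ]

↝-packed-minimal : ∀ {α γ} → α ↝ γ → IsMinimal (Lock α) (Lock (pack γ))
↝-packed-minimal {γ = γ} α↝γ = no-move⇒minimal (proj₂ (↝-trans α↝γ (↝-pack [] γ))) (packed-no-move (packed-pack γ))

largest-empty-below : ∀ D s c r₀ → 1 ≤ r₀ → r₀ < s → D r₀ c ≡ false → ∃[ r' ] Target D s c r'
largest-empty-below D (suc s) c r₀ 1≤r₀ r₀<1+s empty with D s c in Ds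
... | false = s , ≤-trans 1≤r₀ (s≤s⁻¹ r₀<1+s) , ≤-refl , Ds , λ x s<x x<1+s → contradiction (s≤s⁻¹ x<1+s) (<⇒≱ s<x)
... | true with m≤n⇒m<n∨m≡n (s≤s⁻¹ r₀<1+s)
...   | inj₂ refl = contradiction empty (true≢false Ds)
...   | inj₁ r₀<s with largest-empty-below D s c r₀ 1≤r₀ r₀<s empty
...     | r' , 1≤r' , r'<s , empty' , full = r' , 1≤r' , m<n⇒m<1+n r'<s , empty' , full'
  where
  full' : ∀ x → r' < x → x < suc s → D x c ≡ true
  full' x r'<x x<1+s with m≤n⇒m<n∨m≡n (s≤s⁻¹ x<1+s)
  ... | inj₁ x<s = full x r'<x x<s
  ... | inj₂ refl = Ds

stuck⇒full-below-rightmost : ∀ {E} → (∀ F → ¬ KohnertMove E F) → ∀ {s c} → Rightmost E s c →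
                             ∀ s' → 1 ≤ s' → s' < s → E s' c ≡ true
stuck⇒full-below-rightmost {E} stuck {s} {c} rightmost s' 1≤s' s'<s with E s' c in Es'
... | true = refl
... | false with largest-empty-below E s c s' 1≤s' s'<s Es'
...   | r' , target = contradiction (s , c , r' , rightmost , target , ≐-refl) (stuck _)

rightmost-exists : ∀ D s c k → c ≤ k → D s c ≡ true → (∀ c' → k < c' → D s c' ≡ false) →
                   ∃[ c* ] Rightmost D s c*
rightmost-exists D s c k c≤k cell nothing-right with D s k in Dk
... | true = k , Dk , nothing-right
rightmost-exists D s .0 zero z≤n cell _ | false = ⊥-elim (true≢false cell Dk)
rightmost-exists D s c (suc k) c≤1+k cell nothing-right | false with m≤n⇒m<n∨m≡n c≤1+k
... | inj₂ refl = ⊥-elim (true≢false cell Dk)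
... | inj₁ c<1+k = rightmost-exists D s c k (s≤s⁻¹ c<1+k) cell nothing-right'
  where
  nothing-right' : ∀ c' → k < c' → D s c' ≡ false
  nothing-right' c' k<c' with m≤n⇒m<n∨m≡n k<c'
  ... | inj₁ 1+k<c' = nothing-right c' 1+k<c'
  ... | inj₂ refl = Dk

-- Counting cells

indicator : Bool → ℕ
indicator true = 1
indicator false = 0

count : (ℕ → Bool) → ℕ → ℕ → ℕ
count P a zero = 0
count P a (suc t) = count P a t + indicator (P (a + t))

count-cong : ∀ P Q a t → (∀ j → j < t → P (a + j) ≡ Q (a + j)) → count P a t ≡ count Q a t
count-cong P Q a zero _ = refl
count-cong P Q a (suc t) P≡Q =
  cong₂ _+_ (count-cong P Q a t (λ j j<t → P≡Q j (m<n⇒m<1+n j<t))) (cong indicator (P≡Q t ≤-refl))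

count-mono : ∀ P Q a t → (∀ j → j < t → P (a + j) ≡ true → Q (a + j) ≡ true) → count P a t ≤ count Q a t
count-mono P Q a zero _ = z≤n
count-mono P Q a (suc t) P⇒Q =
  +-mono-≤ (count-mono P Q a t (λ j j<t → P⇒Q j (m<n⇒m<1+n j<t))) (indicator-mono (P⇒Q t ≤-refl))
  where
  indicator-mono : ∀ {x y} → (x ≡ true → y ≡ true) → indicator x ≤ indicator y
  indicator-mono {false} _ = z≤n
  indicator-mono {true} x⇒y rewrite x⇒y refl = ≤-refl

count≤ : ∀ P a t → count P a t ≤ t
count≤ P a zero = z≤n
count≤ P a (suc t) = subst (count P a t + indicator (P (a + t)) ≤_) (+-comm t 1)
  (+-mono-≤ (count≤ P a t) (indicator≤1 (P (a + t))))
  where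
  indicator≤1 : ∀ x → indicator x ≤ 1
  indicator≤1 true = ≤-refl
  indicator≤1 false = z≤n

count-+ : ∀ P a t k → count P a (t + k) ≡ count P a t + count P (a + t) k
count-+ P a t zero = trans (cong (count P a) (+-identityʳ t)) (sym (+-identityʳ _))
count-+ P a t (suc k) = begin
  count P a (t + suc k)                                           ≡⟨ cong (count P a) (+-suc t k) ⟩
  count P a (t + k) + indicator (P (a + (t + k)))                 ≡⟨ cong₂ _+_ (count-+ P a t k) (cong (indicator ∘ P) (sym (+-assoc a t k))) ⟩
  count P a t + count P (a + t) k + indicator (P (a + t + k))     ≡⟨ +-assoc (count P a t) _ _ ⟩
  count P a t + count P (a + t) (suc k)                           ∎
  where open ≡-Reasoning

count-monoʳ : ∀ P a {t t'} → t ≤ t' → count P a t ≤ count P a t'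
count-monoʳ P a {t} {t'} t≤t' = begin
  count P a t                                  ≤⟨ m≤m+n _ _ ⟩
  count P a t + count P (a + t) (t' ∸ t)       ≡⟨ sym (count-+ P a t _) ⟩
  count P a (t + (t' ∸ t))                     ≡⟨ cong (count P a) (m+[n∸m]≡n t≤t') ⟩
  count P a t'                                 ∎
  where open ≤-Reasoning

count-all : ∀ P a t → (∀ j → j < t → P (a + j) ≡ true) → count P a t ≡ t
count-all P a zero _ = refl
count-all P a (suc t) all
  rewrite count-all P a t (λ j j<t → all j (m<n⇒m<1+n j<t)) | all t ≤-refl = +-comm t 1

count-none : ∀ P a t → (∀ j → j < t → P (a + j) ≡ false) → count P a t ≡ 0
count-none P a zero _ = refl
count-none P a (suc t) none
  rewrite count-none P a t (λ j j<t → none j (m<n⇒m<1+n j<t)) | none t ≤-refl = refl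

count-full : ∀ P a t → count P a t ≡ t → ∀ j → j < t → P (a + j) ≡ true
count-full P a (suc t) full j j<1+t with P (a + t) in Pt
... | false = contradiction (subst (_≤ t) (trans (sym (+-identityʳ _)) full) (count≤ P a t)) (n≮n t)
... | true with m≤n⇒m<n∨m≡n (s≤s⁻¹ j<1+t)
...   | inj₁ j<t = count-full P a t (+-cancelʳ-≡ 1 _ _ (trans full (+-comm 1 t))) j j<t
...   | inj₂ refl = Pt

count-witness : ∀ P a t → 0 < count P a t → ∃[ j ] j < t × P (a + j) ≡ true
count-witness P a (suc t) pos with P (a + t) in Pt
... | true = t , ≤-refl , Pt
... | false with count-witness P a t (subst (0 <_) (+-identityʳ _) pos)
...   | j , j<t , Pj = j , m<n⇒m<1+n j<t , Pj

witness-count : ∀ P a t j → j < t → P (a + j) ≡ true → 0 < count P a t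
witness-count P a (suc t) j j<1+t Pj with m≤n⇒m<n∨m≡n (s≤s⁻¹ j<1+t)
... | inj₁ j<t = <-≤-trans (witness-count P a t j j<t Pj) (m≤m+n _ _)
... | inj₂ refl rewrite Pj = subst (0 <_) (+-comm 1 _) (s≤s z≤n)

module CountAfterMove (P P' : ℕ → Bool) (a : ℕ) {i' i : ℕ} (i'<i : i' < i)
  (source : P (a + i) ≡ true) (source' : P' (a + i) ≡ false)
  (target : P (a + i') ≡ false) (target' : P' (a + i') ≡ true)
  (unchanged : ∀ j → j ≢ i → j ≢ i' → P' (a + j) ≡ P (a + j)) where

  private
    gained : ℕ → ℕ
    gained t = indicator (between i' i t)

    gained-inside : ∀ {t} → i' < t → t ≤ i → gained t ≡ 1
    gained-inside i'<t t≤i = cong indicator (between-intro i'<t t≤i)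

    gained-outside : ∀ {t} → ¬ (i' < t × t ≤ i) → gained t ≡ 0
    gained-outside outside = cong indicator (between-outside outside)

    gained-step : ∀ t → gained t + indicator (P' (a + t)) ≡ indicator (P (a + t)) + gained (suc t)
    gained-step t with <-cmp t i'
    ... | tri< t<i' _ _
      rewrite gained-outside {t} (λ (i'<t , _) → <-asym t<i' i'<t) | gained-outside {suc t} (λ (i'<1+t , _) → <⇒≱ i'<1+t t<i')
            | unchanged t (<⇒≢ (<-trans t<i' i'<i)) (<⇒≢ t<i') = +-comm 0 _
    ... | tri≈ _ refl _
      rewrite gained-outside {t} (λ (t<t , _) → <-irrefl refl t<t) | gained-inside {suc t} ≤-refl i'<i
            | target | target' = refl
    ... | tri> _ _ i'<t with <-cmp t i
    ...   | tri< t<i _ _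
      rewrite gained-inside i'<t (<⇒≤ t<i) | gained-inside (m<n⇒m<1+n i'<t) t<i
            | unchanged t (<⇒≢ t<i) (≢-sym (<⇒≢ i'<t)) = +-comm 1 _
    ...   | tri≈ _ refl _
      rewrite gained-inside i'<t ≤-refl | gained-outside {suc t} (λ (_ , 1+t≤t) → n≮n t 1+t≤t)
            | source | source' = refl
    ...   | tri> _ _ i<t
      rewrite gained-outside {t} (λ (_ , t≤i) → <⇒≱ i<t t≤i) | gained-outside {suc t} (λ (_ , 1+t≤i) → <⇒≱ (m<n⇒m<1+n i<t) 1+t≤i)
            | unchanged t (≢-sym (<⇒≢ i<t)) (≢-sym (<⇒≢ (<-trans i'<i i<t))) = +-comm 0 _

    count-gained : ∀ t → count P' a t ≡ count P a t + gained t
    count-gained zero = sym (gained-outside λ ())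
    count-gained (suc t) = begin
      count P' a t + indicator (P' (a + t))                   ≡⟨ cong (_+ indicator (P' (a + t))) (count-gained t) ⟩
      count P a t + gained t + indicator (P' (a + t))         ≡⟨ +-assoc (count P a t) _ _ ⟩
      count P a t + (gained t + indicator (P' (a + t)))       ≡⟨ cong (count P a t +_) (gained-step t) ⟩
      count P a t + (indicator (P (a + t)) + gained (suc t))  ≡⟨ sym (+-assoc (count P a t) _ _) ⟩
      count P a (suc t) + gained (suc t)                      ∎
      where open ≡-Reasoning

  count-moved-inside : ∀ t → i' < t → t ≤ i → count P' a t ≡ count P a t + 1
  count-moved-inside t i'<t t≤i = trans (count-gained t) (cong (count P a t +_) (gained-inside i'<t t≤i))

  count-moved-outside : ∀ t → ¬ (i' < t × t ≤ i) → count P' a t ≡ count P a t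
  count-moved-outside t outside =
    trans (count-gained t) (trans (cong (count P a t +_) (gained-outside outside)) (+-identityʳ _))

  count-moved-≥ : ∀ t → count P a t ≤ count P' a t
  count-moved-≥ t = subst (count P a t ≤_) (sym (count-gained t)) (m≤m+n _ _)

-- The invariant

-- For Lock α, z - 1 is the length of the longest prefix of α without zero entries.
module SortedFrom (m n z : ℕ) (f : ℕ → ℕ) (1≤z : 1 ≤ z)
  (nonempty-below : ∀ s → 1 ≤ s → s < z → 1 ≤ f s)
  (empty-above : ∀ s → n < s → f s ≡ 0)
  (f≤m : ∀ s → f s ≤ m)
  (sorted : ∀ s s' → z ≤ s → s ≤ s' → 1 ≤ f s → 1 ≤ f s' → f s ≤ f s') where

  L₀ : Diagram
  L₀ = lockDiagram m f

  column : Diagram → ℕ → ℕ → Bool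
  column D c s = D s c

  colCount : Diagram → ℕ → ℕ → ℕ
  colCount D c t = count (column D c) z t

  total : ℕ → ℕ
  total c = colCount L₀ c n

  record InBox (s c : ℕ) : Set where
    constructor box
    field
      1≤row : 1 ≤ s
      row≤n : s ≤ n
      1≤col : 1 ≤ c
      col≤m : c ≤ m

  open InBox

  record Invariant (D : Diagram) : Set where
    field
      bounded : ∀ s c → D s c ≡ true → InBox s c
      fixed-below : ∀ s c → s < z → D s c ≡ L₀ s c
      totals : ∀ c → colCount D c n ≡ total c
      -- above row z + t - 1, column c keeps at least as many cells as column m,
      -- as soon as column c has a cell at or below that row
      dominance : ∀ c t → c < m → t ≤ n → 0 < colCount D c t →
                  colCount D c t + total m ≤ colCount D m t + total c

  L₀-last-column : ∀ s c → L₀ s c ≡ true → L₀ s m ≡ true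
  L₀-last-column s c cell with lock-elim f s c cell
  ... | cell′@(1≤s , 1≤c , c≤m , _) = lock-last-column f 1≤s (≤-trans 1≤c c≤m) (lock-row-nonempty f cell′)

  L₀-below-z : ∀ s → 1 ≤ s → s < z → L₀ s m ≡ true
  L₀-below-z s 1≤s s<z = lock-last-column f 1≤s (≤-trans (nonempty-below s 1≤s s<z) (f≤m s)) (nonempty-below s 1≤s s<z)

  L₀-upward : ∀ {s s' c} → z ≤ s → s ≤ s' → L₀ s c ≡ true → L₀ s' m ≡ true → L₀ s' c ≡ true
  L₀-upward {s} {s'} {c} z≤s s≤s' cell last with lock-elim f s c cell | lock-elim f s' m last
  ... | cell′@(_ , 1≤c , c≤m , m<c+fs) | last′@(1≤s' , _ , _ , _) =
    lock-intro f (1≤s' , 1≤c , c≤m , <-≤-trans m<c+fs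
      (+-monoʳ-≤ c (sorted s s' z≤s s≤s' (lock-row-nonempty f cell′) (lock-row-nonempty f last′))))

  total≤total-m : ∀ c → total c ≤ total m
  total≤total-m c = count-mono (column L₀ c) (column L₀ m) z n (λ j _ → L₀-last-column (z + j) c)

  colCount-cong : ∀ {D D'} → D ≐ D' → ∀ c t → colCount D c t ≡ colCount D' c t
  colCount-cong D≐D' c t = count-cong _ _ z t (λ j _ → D≐D' (z + j) c)

  Invariant-resp : ∀ {D D'} → D ≐ D' → Invariant D → Invariant D'
  Invariant-resp {D} {D'} D≐D' I = record
    { bounded = λ s c cell → bounded s c (trans (D≐D' s c) cell)
    ; fixed-below = λ s c s<z → trans (sym (D≐D' s c)) (fixed-below s c s<z)
    ; totals = λ c → trans (sym (colCount-cong D≐D' c n)) (totals c)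
    ; dominance = λ c t c<m t≤n pos →
        subst₂ (λ x y → x + total m ≤ y + total c) (colCount-cong D≐D' c t) (colCount-cong D≐D' m t)
          (dominance c t c<m t≤n (subst (0 <_) (sym (colCount-cong D≐D' c t)) pos))
    }
    where open Invariant I

  Invariant-L₀ : Invariant L₀
  Invariant-L₀ = record
    { bounded = bounded
    ; fixed-below = λ _ _ _ → refl
    ; totals = λ _ → refl
    ; dominance = dominance
    }
    where
    bounded : ∀ s c → L₀ s c ≡ true → InBox s c
    bounded s c cell with lock-elim f s c cell
    ... | cell′@(1≤s , 1≤c , c≤m , _) =
      box 1≤s (≮⇒≥ (λ n<s → contradiction (empty-above s n<s) (≢-sym (<⇒≢ (lock-row-nonempty f cell′))))) 1≤c c≤m

    dominance : ∀ c t → c < m → t ≤ n → 0 < colCount L₀ c t →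
                colCount L₀ c t + total m ≤ colCount L₀ m t + total c
    dominance c t _ t≤n pos with count-witness (column L₀ c) z t pos
    ... | j , j<t , cell = begin
      a + total m             ≡⟨ cong (a +_) (split m) ⟩
      a + (b + tail m)        ≤⟨ +-monoʳ-≤ a (+-monoʳ-≤ b tail-m≤tail-c) ⟩
      a + (b + tail c)        ≡⟨ sym (+-assoc a b _) ⟩
      a + b + tail c          ≡⟨ cong (_+ tail c) (+-comm a b) ⟩
      b + a + tail c          ≡⟨ +-assoc b a _ ⟩
      b + (a + tail c)        ≡⟨ cong (b +_) (sym (split c)) ⟩
      b + total c             ∎
      where
      open ≤-Reasoning
      a = colCount L₀ c t
      b = colCount L₀ m t
      tail : ℕ → ℕ
      tail d = count (column L₀ d) (z + t) (n ∸ t)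
      split : ∀ d → total d ≡ colCount L₀ d t + tail d
      split d = trans (cong (colCount L₀ d) (sym (m+[n∸m]≡n t≤n))) (count-+ (column L₀ d) z t (n ∸ t))
      tail-m≤tail-c : tail m ≤ tail c
      tail-m≤tail-c = count-mono (column L₀ m) (column L₀ c) (z + t) (n ∸ t) λ k _ →
        L₀-upward {c = c} (m≤m+n z j) (≤-trans (+-monoʳ-≤ z (<⇒≤ j<t)) (m≤m+n (z + t) k)) cell

  -- dominance at height i + 1, carried down to height t along the full segment of column c
  dominance-strict : ∀ {D} → Invariant D → ∀ {c t i} → c < m → t ≤ i → i < n →
    (∀ s → z + t ≤ s → s ≤ z + i → D s c ≡ true) → D (z + i) m ≡ false →
    colCount D c t + 1 + total m ≤ colCount D m t + total c
  dominance-strict {D} I {c} {t} {i} c<m t≤i i<n full empty =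
    +-cancelˡ-≤ k _ _ (begin
      k + (colCount D c t + 1 + total m)        ≡⟨ rearrangeˡ (colCount D c t) k (total m) ⟩
      colCount D c t + suc k + total m          ≡⟨ cong (_+ total m) (sym count-c) ⟩
      colCount D c (suc i) + total m            ≤⟨ dominance c (suc i) c<m i<n (subst (0 <_) (sym count-c) (≤-trans (s≤s z≤n) (m≤n+m (suc k) _))) ⟩
      colCount D m (suc i) + total c            ≤⟨ +-monoˡ-≤ (total c) count-m ⟩
      colCount D m t + k + total c              ≡⟨ rearrangeʳ (colCount D m t) k (total c) ⟩
      k + (colCount D m t + total c)            ∎)
    where
    open Invariant I
    open ≤-Reasoning
    k = i ∸ t
    t+k≡i : t + k ≡ i
    t+k≡i = m+[n∸m]≡n t≤i
    z+t+k≡z+i : z + t + k ≡ z + i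
    z+t+k≡z+i = trans (+-assoc z t k) (cong (z +_) t+k≡i)
    count-c : colCount D c (suc i) ≡ colCount D c t + suc k
    count-c = trans (sym (cong (count (column D c) z) (trans (+-suc t k) (cong suc t+k≡i))))
      (trans (count-+ (column D c) z t (suc k)) (cong (colCount D c t +_)
        (count-all (column D c) (z + t) (suc k) λ j j≤k →
          full (z + t + j) (m≤m+n _ j) (≤-trans (+-monoʳ-≤ (z + t) (s≤s⁻¹ j≤k)) (≤-reflexive z+t+k≡z+i)))))
    count-m : colCount D m (suc i) ≤ colCount D m t + k
    count-m = begin
      colCount D m (suc i)                                          ≡⟨ cong (count (column D m) z) (sym (trans (+-suc t k) (cong suc t+k≡i))) ⟩
      count (column D m) z (t + suc k)                              ≡⟨ count-+ (column D m) z t (suc k) ⟩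
      colCount D m t + (count (column D m) (z + t) k + indicator (D (z + t + k) m))
                                                                    ≡⟨ cong (λ x → colCount D m t + (count (column D m) (z + t) k + indicator x))
                                                                            (trans (cong (λ s → D s m) z+t+k≡z+i) empty) ⟩
      colCount D m t + (count (column D m) (z + t) k + 0)           ≤⟨ +-monoʳ-≤ (colCount D m t) (≤-reflexive (+-identityʳ _)) ⟩
      colCount D m t + count (column D m) (z + t) k                 ≤⟨ +-monoʳ-≤ (colCount D m t) (count≤ _ _ k) ⟩
      colCount D m t + k                                            ∎
    rearrangeˡ : ∀ a k N → k + (a + 1 + N) ≡ a + suc k + N
    rearrangeˡ = solve-∀
    rearrangeʳ : ∀ b k N → b + k + N ≡ k + (b + N)
    rearrangeʳ = solve-∀

  last-column-below-z : ∀ {D} → Invariant D → ∀ {s} → 1 ≤ s → s < z → D s m ≡ true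
  last-column-below-z I {s} 1≤s s<z = trans (Invariant.fixed-below I s m s<z) (L₀-below-z s 1≤s s<z)

  module AfterMove {D : Diagram} (I : Invariant D) {r c r' : ℕ}
    (cell : D r c ≡ true) (nothing-right : ∀ c' → c < c' → D r c' ≡ false)
    (1≤r' : 1 ≤ r') (r'<r : r' < r) (empty : D r' c ≡ false) (full : ∀ s → r' < s → s < r → D s c ≡ true) where

    open Invariant I

    private
      D' : Diagram
      D' = moveCell D r c r'

      1≤r = 1≤row (bounded r c cell)
      r≤n = row≤n (bounded r c cell)
      c≤m = col≤m (bounded r c cell)

      column-full : ∀ s → r' < s → s ≤ r → D s c ≡ true
      column-full s r'<s s≤r with m≤n⇒m<n∨m≡n s≤r
      ... | inj₁ s<r = full s r'<s s<r
      ... | inj₂ refl = cell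

      c<m⇒last-empty : c < m → D r m ≡ false
      c<m⇒last-empty c<m = nothing-right m c<m

    source-above-z : z ≤ r
    source-above-z = ≮⇒≥ λ r<z →
      let c≡m = ≮⇒≥ (λ c<m → true≢false (last-column-below-z I 1≤r r<z) (c<m⇒last-empty c<m)) in
      true≢false (last-column-below-z I 1≤r' (<-trans r'<r r<z)) (subst (λ d → D r' d ≡ false) (≤-antisym c≤m c≡m) empty)

    private
      i = r ∸ z
      z+i≡r = m+[n∸m]≡n source-above-z
      i<n : i < n
      i<n = <-≤-trans (subst (i <_) (trans (+-comm i z) z+i≡r) (m<m+n i 1≤z)) r≤n

      target-below-z-impossible : r' < z → c < m → ⊥
      target-below-z-impossible r'<z c<m = <⇒≱
        (dominance-strict I {t = 0} c<m z≤n i<n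
          (λ s z+0≤s s≤z+i → column-full s (<-≤-trans r'<z (≤-trans (m≤m+n z 0) z+0≤s)) (subst (s ≤_) z+i≡r s≤z+i))
          (subst (λ s → D s m ≡ false) (sym z+i≡r) (c<m⇒last-empty c<m)))
        (total≤total-m c)

    target-above-z : z ≤ r'
    target-above-z = ≮⇒≥ λ r'<z → case m≤n⇒m<n∨m≡n c≤m of λ where
      (inj₂ refl) → true≢false (last-column-below-z I 1≤r' r'<z) empty
      (inj₁ c<m) → target-below-z-impossible r'<z c<m

    private
      i' = r' ∸ z
      z+i'≡r' = m+[n∸m]≡n target-above-z

      i'<i : i' < i
      i'<i = +-cancelˡ-< z i' i (subst₂ _<_ (sym z+i'≡r') (sym z+i≡r) r'<r)

      module Moved = CountAfterMove (column D c) (column D' c) z i'<i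
        (subst (λ s → D s c ≡ true) (sym z+i≡r) cell)
        (subst (λ s → D' s c ≡ false) (sym z+i≡r) (moveCell-source D r c r'))
        (subst (λ s → D s c ≡ false) (sym z+i'≡r') empty)
        (subst (λ s → D' s c ≡ true) (sym z+i'≡r') (moveCell-target D r c r' (<⇒≢ r'<r)))
        (λ j j≢i j≢i' → moveCell-otherRow D r c r' (z + j) c
          (j≢i ∘ +-cancelˡ-≡ z j i ∘ flip trans (sym z+i≡r))
          (j≢i' ∘ +-cancelˡ-≡ z j i' ∘ flip trans (sym z+i'≡r')))

      colCount-other : ∀ {d} t → d ≢ c → colCount D' d t ≡ colCount D d t
      colCount-other t d≢c = count-cong _ _ z t (λ j _ → moveCell-otherColumn D r c r' (z + j) _ d≢c)

      dominance-kept : ∀ {d t} → d < m → t ≤ n → 0 < colCount D' d t →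
        colCount D' d t ≡ colCount D d t → colCount D m t ≤ colCount D' m t →
        colCount D' d t + total m ≤ colCount D' m t + total d
      dominance-kept {d} {t} d<m t≤n pos same-d more-m = begin
        colCount D' d t + total m     ≡⟨ cong (_+ total m) same-d ⟩
        colCount D d t + total m      ≤⟨ dominance d t d<m t≤n (subst (0 <_) same-d pos) ⟩
        colCount D m t + total d      ≤⟨ +-monoˡ-≤ (total d) more-m ⟩
        colCount D' m t + total d     ∎
        where open ≤-Reasoning

      dominance-moved-column : c < m → ∀ t → t ≤ n → 0 < colCount D' c t →
        colCount D' c t + total m ≤ colCount D' m t + total c
      dominance-moved-column c<m t t≤n pos with i' <? t | t ≤? i
      ... | yes i'<t | yes t≤i = begin
        colCount D' c t + total m         ≡⟨ cong (_+ total m) (Moved.count-moved-inside t i'<t t≤i) ⟩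
        colCount D c t + 1 + total m      ≤⟨ dominance-strict I c<m t≤i i<n
                                               (λ s z+t≤s s≤z+i → column-full s
                                                  (<-≤-trans (subst (_< z + t) z+i'≡r' (+-monoʳ-< z i'<t)) z+t≤s)
                                                  (subst (s ≤_) z+i≡r s≤z+i))
                                               (subst (λ s → D s m ≡ false) (sym z+i≡r) (c<m⇒last-empty c<m)) ⟩
        colCount D m t + total c          ≡⟨ cong (_+ total c) (sym (colCount-other t (≢-sym (<⇒≢ c<m)))) ⟩
        colCount D' m t + total c         ∎
        where open ≤-Reasoning
      ... | no i'≮t | _ = dominance-kept c<m t≤n pos (Moved.count-moved-outside t λ (i'<t , _) → i'≮t i'<t)
                            (≤-reflexive (sym (colCount-other t (≢-sym (<⇒≢ c<m)))))
      ... | _ | no t≰i = dominance-kept c<m t≤n pos (Moved.count-moved-outside t λ (_ , t≤i) → t≰i t≤i)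
                            (≤-reflexive (sym (colCount-other t (≢-sym (<⇒≢ c<m)))))

    invariant : Invariant D'
    invariant = record
      { bounded = bounded'
      ; fixed-below = λ s d s<z → trans
          (moveCell-otherRow D r c r' s d (<⇒≢ (<-≤-trans s<z source-above-z)) (<⇒≢ (<-≤-trans s<z target-above-z)))
          (fixed-below s d s<z)
      ; totals = λ d → by-≟ {λ d → colCount D' d n ≡ total d} d c
          (trans (Moved.count-moved-outside n λ (_ , n≤i) → <⇒≱ i<n n≤i) (totals c))
          (λ d≢c → trans (colCount-other n d≢c) (totals d))
      ; dominance = dominance'
      }
      where
      bounded' : ∀ s d → D' s d ≡ true → InBox s d
      bounded' s d cell' with moveCell-true D r c r' s d cell'
      ... | inj₁ (refl , refl) = box 1≤r' (<⇒≤ (<-≤-trans r'<r r≤n)) (1≤col (bounded r c cell)) c≤m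
      ... | inj₂ old = bounded s d old

      dominance' : ∀ d t → d < m → t ≤ n → 0 < colCount D' d t →
                   colCount D' d t + total m ≤ colCount D' m t + total d
      dominance' d t d<m t≤n pos with m≤n⇒m<n∨m≡n c≤m
      ... | inj₂ refl = dominance-kept d<m t≤n pos (colCount-other t (<⇒≢ d<m)) (Moved.count-moved-≥ t)
      ... | inj₁ c<m = by-≟ {λ d → d < m → 0 < colCount D' d t → colCount D' d t + total m ≤ colCount D' m t + total d} d c
          (λ _ → dominance-moved-column c<m t t≤n)
          (λ d≢c d<m pos → dominance-kept d<m t≤n pos (colCount-other t d≢c)
                             (≤-reflexive (sym (colCount-other t (≢-sym (<⇒≢ c<m))))))
          d<m pos

  Invariant-step : ∀ {D E} → Invariant D → KohnertMove D E → Invariant E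
  Invariant-step I (r , c , r' , (cell , nothing-right) , (1≤r' , r'<r , empty , full) , E≐) =
    Invariant-resp (≐-sym E≐) (AfterMove.invariant I cell nothing-right 1≤r' r'<r empty full)

  Invariant-reachable : ∀ {E} → InP L₀ E → Invariant E
  Invariant-reachable (F , moves , F≐E) = Invariant-resp F≐E (along moves Invariant-L₀)
    where
    along : ∀ {D F} → Star KohnertMove D F → Invariant D → Invariant F
    along ε I = I
    along (move ◅ moves) I = along moves (Invariant-step I move)

  -- the shape of the unique stable diagram: column c occupies the top total c of the
  -- rows z, …, z + total m - 1
  Shape : ℕ → ℕ → Set
  Shape s c = (s < z × L₀ s c ≡ true)
            ⊎ (∃[ j ] s ≡ z + j × j < total m × total m ≤ j + total c × 1 ≤ c × c ≤ m)

  module Stable {E : Diagram} (I : Invariant E) (stuck : ∀ F → ¬ KohnertMove E F) where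

    open Invariant I

    private
      k = total m

      suc-j≤n : ∀ {j c} → E (z + j) c ≡ true → suc j ≤ n
      suc-j≤n {j} {c} cell = ≤-trans (+-monoˡ-≤ j 1≤z) (row≤n (bounded (z + j) c cell))

      k≤n : k ≤ n
      k≤n = subst (_≤ n) (totals m) (count≤ _ _ n)

      nothing-right-of-m : ∀ s c' → m < c' → E s c' ≡ false
      nothing-right-of-m s c' m<c' = ¬true⇒false λ cell → <⇒≱ m<c' (col≤m (bounded s c' cell))

    rightmost⇒height≤total : ∀ {j c} → Rightmost E (z + j) c → suc j ≤ total c
    rightmost⇒height≤total {j} {c} rightmost = begin
      suc j                    ≡⟨ sym (count-all (column E c) z (suc j) full) ⟩
      colCount E c (suc j)     ≤⟨ count-monoʳ (column E c) z (suc-j≤n (proj₁ rightmost)) ⟩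
      colCount E c n           ≡⟨ totals c ⟩
      total c                  ∎
      where
      open ≤-Reasoning
      full : ∀ j' → j' < suc j → E (z + j') c ≡ true
      full j' j'<1+j with m≤n⇒m<n∨m≡n (s≤s⁻¹ j'<1+j)
      ... | inj₁ j'<j = stuck⇒full-below-rightmost stuck rightmost (z + j')
                          (≤-trans 1≤z (m≤m+n z j')) (+-monoʳ-< z j'<j)
      ... | inj₂ refl = proj₁ rightmost

    empty-from-k : ∀ j c → k ≤ j → E (z + j) c ≡ false
    empty-from-k j c k≤j = ¬true⇒false λ cell →
      let c* , rightmost = rightmost-exists E (z + j) c m (col≤m (bounded _ c cell))
                                 cell (nothing-right-of-m (z + j))
      in n≮n j (≤-trans (rightmost⇒height≤total rightmost) (≤-trans (total≤total-m c*) k≤j))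

    last-column-filled : ∀ j → j < k → E (z + j) m ≡ true
    last-column-filled j j<k with E (z + j) m in gap
    ... | true = refl
    ... | false = contradiction j<k (≤⇒≯ (begin
      k                                                       ≡⟨ sym (totals m) ⟩
      colCount E m n                                          ≡⟨ cong (colCount E m) (sym (m+[n∸m]≡n j≤n)) ⟩
      colCount E m (j + (n ∸ j))                              ≡⟨ count-+ (column E m) z j (n ∸ j) ⟩
      colCount E m j + count (column E m) (z + j) (n ∸ j)     ≡⟨ cong (colCount E m j +_) (count-none _ _ _ above-gap) ⟩
      colCount E m j + 0                                      ≤⟨ ≤-reflexive (+-identityʳ _) ⟩
      colCount E m j                                          ≤⟨ count≤ _ _ j ⟩
      j                                                       ∎))
      where
      open ≤-Reasoning
      j≤n : j ≤ n
      j≤n = ≤-trans (<⇒≤ j<k) k≤n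
      above-gap : ∀ j' → j' < n ∸ j → E (z + j + j') m ≡ false
      above-gap j' _ = ¬true⇒false λ cell → case m≤n⇒m<n∨m≡n (m≤m+n j j') of λ where
        (inj₂ j≡j+j') → true≢false (subst (λ s → E s m ≡ true) (trans (+-assoc z j j') (cong (z +_) (sym j≡j+j'))) cell) gap
        (inj₁ j<j+j') → true≢false
          (stuck⇒full-below-rightmost stuck (cell , nothing-right-of-m _) (z + j)
            (≤-trans 1≤z (m≤m+n z j)) (subst (z + j <_) (sym (+-assoc z j j')) (+-monoʳ-< z j<j+j')))
          gap

    cell-lower-bound : ∀ j c → c < m → E (z + j) c ≡ true → k ≤ j + total c
    cell-lower-bound j c c<m cell with j <? k
    ... | no j≮k = ≤-trans (≮⇒≥ j≮k) (m≤m+n j _)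
    ... | yes j<k = +-cancelˡ-≤ 1 _ _ (begin
      1 + k                              ≤⟨ +-monoˡ-≤ k (witness-count (column E c) z (suc j) j ≤-refl cell) ⟩
      colCount E c (suc j) + k           ≤⟨ dominance c (suc j) c<m (suc-j≤n cell) (witness-count (column E c) z (suc j) j ≤-refl cell) ⟩
      colCount E m (suc j) + total c     ≡⟨ cong (_+ total c) (count-all (column E m) z (suc j)
                                              λ j' j'≤j → last-column-filled j' (≤-<-trans (s≤s⁻¹ j'≤j) j<k)) ⟩
      suc j + total c                    ∎)
      where open ≤-Reasoning

    cell-filled : ∀ j c → j < k → k ≤ j + total c → 1 ≤ c → c ≤ m → E (z + j) c ≡ true
    cell-filled j c j<k k≤j+N 1≤c c≤m with m≤n⇒m<n∨m≡n c≤m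
    ... | inj₂ refl = last-column-filled j j<k
    ... | inj₁ c<m = subst (λ s → E s c ≡ true) row≡
                       (count-full (column E c) (z + a) N window-full (j ∸ a) j∸a<N)
      where
      open ≡-Reasoning
      N = total c
      a = k ∸ N
      a+N≡k : a + N ≡ k
      a+N≡k = m∸n+n≡m (total≤total-m c)
      a≤j : a ≤ j
      a≤j = subst (a ≤_) (m+n∸n≡m j N) (∸-monoˡ-≤ N k≤j+N)
      row≡ : z + a + (j ∸ a) ≡ z + j
      row≡ = trans (+-assoc z a _) (cong (z +_) (m+[n∸m]≡n a≤j))
      j∸a<N : j ∸ a < N
      j∸a<N = +-cancelˡ-< a _ _ (subst₂ _<_ (sym (m+[n∸m]≡n a≤j)) (sym a+N≡k) j<k)
      below : ∀ j' → j' < a → E (z + j') c ≡ false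
      below j' j'<a = ¬true⇒false λ cell →
        <⇒≱ j'<a (subst (a ≤_) (m+n∸n≡m j' N) (∸-monoˡ-≤ N (cell-lower-bound j' c c<m cell)))
      above : ∀ j' → j' < n ∸ k → E (z + a + N + j') c ≡ false
      above j' _ = subst (λ s → E s c ≡ false) (cong (_+ j') (sym (trans (+-assoc z a N) (cong (z +_) a+N≡k))))
                     (subst (λ s → E s c ≡ false) (sym (+-assoc z k j')) (empty-from-k (k + j') c (m≤m+n k j')))
      window-full : count (column E c) (z + a) N ≡ N
      window-full = sym (begin
        N                                                            ≡⟨ sym (totals c) ⟩
        colCount E c n                                               ≡⟨ cong (colCount E c) (sym n≡) ⟩
        colCount E c (a + (N + (n ∸ k)))                              ≡⟨ count-+ (column E c) z a _ ⟩
        colCount E c a + count (column E c) (z + a) (N + (n ∸ k))    ≡⟨ cong₂ _+_ (count-none _ z a below) (count-+ (column E c) (z + a) N _) ⟩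
        count (column E c) (z + a) N + count (column E c) (z + a + N) (n ∸ k)
                                                                     ≡⟨ cong (count (column E c) (z + a) N +_) (count-none _ _ _ above) ⟩
        count (column E c) (z + a) N + 0                             ≡⟨ +-identityʳ _ ⟩
        count (column E c) (z + a) N                                 ∎)
        where
        n≡ : a + (N + (n ∸ k)) ≡ n
        n≡ = trans (sym (+-assoc a N _)) (trans (cong (_+ (n ∸ k)) a+N≡k) (m+[n∸m]≡n k≤n))

    stable⇒shape : ∀ s c → E s c ≡ true → Shape s c
    stable⇒shape s c cell with s <? z
    ... | yes s<z = inj₁ (s<z , trans (sym (fixed-below s c s<z)) cell)
    ... | no s≮z = inj₂ (j , sym z+j≡s , j<k , k≤j+N , 1≤c , c≤m)
      where
      j = s ∸ z
      z+j≡s = m+[n∸m]≡n (≮⇒≥ s≮z)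
      cell' = subst (λ s → E s c ≡ true) (sym z+j≡s) cell
      1≤c = 1≤col (bounded s c cell)
      c≤m = col≤m (bounded s c cell)
      j<k : j < k
      j<k = ≰⇒> λ k≤j → true≢false cell' (empty-from-k j c k≤j)
      k≤j+N : k ≤ j + total c
      k≤j+N with m≤n⇒m<n∨m≡n c≤m
      ... | inj₁ c<m = cell-lower-bound j c c<m cell'
      ... | inj₂ refl = m≤n+m k j

    shape⇒stable : ∀ s c → Shape s c → E s c ≡ true
    shape⇒stable s c (inj₁ (s<z , cell₀)) = trans (fixed-below s c s<z) cell₀
    shape⇒stable s c (inj₂ (j , refl , j<k , k≤j+N , 1≤c , c≤m)) = cell-filled j c j<k k≤j+N 1≤c c≤m

  stable-unique : ∀ {E E'} → Invariant E → (∀ F → ¬ KohnertMove E F) →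
                  Invariant E' → (∀ F → ¬ KohnertMove E' F) → E ≐ E'
  stable-unique I stuck I' stuck' s c = ≡true-ext
    (Stable.shape⇒stable I' stuck' s c ∘ Stable.stable⇒shape I stuck s c)
    (Stable.shape⇒stable I stuck s c ∘ Stable.stable⇒shape I' stuck' s c)

-- Sorted tails: the packed lock diagram is the unique minimal element

entry-prefix-positive : ∀ {P} ρ → All (0 <_) P → ∀ s → 1 ≤ s → s ≤ length P → 1 ≤ entry (P ++ ρ) s
entry-prefix-positive ρ (0<x ∷ _) 1 _ _ = 0<x
entry-prefix-positive ρ (_ ∷ P₊) (suc (suc s)) _ (s≤s s≤∣P∣) = entry-prefix-positive ρ P₊ (suc s) (s≤s z≤n) s≤∣P∣

entry-beyond-length : ∀ α s → length α < s → entry α s ≡ 0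
entry-beyond-length [] zero _ = refl
entry-beyond-length [] (suc s) _ = refl
entry-beyond-length (a ∷ α) (suc (suc s)) (s≤s ∣α∣<s) = entry-beyond-length α (suc s) ∣α∣<s

entry-nonzeros-All : ∀ {Q : ℕ → Set} ρ → All Q (nonzeros ρ) → ∀ i → 1 ≤ entry ρ i → Q (entry ρ i)
entry-nonzeros-All (zero ∷ ρ) all (suc (suc i)) pos = entry-nonzeros-All ρ all (suc i) pos
entry-nonzeros-All (suc x ∷ ρ) (qx ∷ _) 1 _ = qx
entry-nonzeros-All (suc x ∷ ρ) (_ ∷ all) (suc (suc i)) pos = entry-nonzeros-All ρ all (suc i) pos

nonzero-entries-sorted : ∀ ρ → AllPairs _≤_ (nonzeros ρ) → ∀ {i i'} → i ≤ i' →
                         1 ≤ entry ρ i → 1 ≤ entry ρ i' → entry ρ i ≤ entry ρ i'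
nonzero-entries-sorted (zero ∷ ρ) sorted {suc (suc i)} {suc (suc i')} (s≤s i≤i') pos pos' =
  nonzero-entries-sorted ρ sorted i≤i' pos pos'
nonzero-entries-sorted (suc x ∷ ρ) _ {1} {1} _ _ _ = ≤-refl
nonzero-entries-sorted (suc x ∷ ρ) (head ∷ _) {1} {suc (suc i')} _ _ pos' = entry-nonzeros-All ρ head (suc i') pos'
nonzero-entries-sorted (suc x ∷ ρ) (_ ∷ sorted) {suc (suc i)} {suc (suc i')} (s≤s i≤i') pos pos' =
  nonzero-entries-sorted ρ sorted i≤i' pos pos'

nonzero-entries-sorted-after : ∀ P ρ → AllPairs _≤_ (nonzeros ρ) → ∀ {s s'} → length P < s → s ≤ s' →
  1 ≤ entry (P ++ ρ) s → 1 ≤ entry (P ++ ρ) s' → entry (P ++ ρ) s ≤ entry (P ++ ρ) s'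
nonzero-entries-sorted-after [] ρ sorted _ = nonzero-entries-sorted ρ sorted
nonzero-entries-sorted-after (x ∷ P) ρ sorted {suc (suc s)} {suc (suc s')} (s≤s ∣P∣<s) (s≤s s≤s') =
  nonzero-entries-sorted-after P ρ sorted ∣P∣<s s≤s'

sorted-tail⇒unique-minimal : ∀ P ρ → All (0 <_) P → Linked _≤_ (nonzeros ρ) → HasUniqueMinimal (Lock (P ++ ρ))
sorted-tail⇒unique-minimal P ρ P₊ ρ-sorted =
  Lock (pack α) , packed-minimal , λ _ minimal' →
    stable-unique (Invariant-reachable (proj₁ minimal')) (minimal⇒no-move minimal')
                  (Invariant-reachable (proj₁ packed-minimal)) (minimal⇒no-move packed-minimal)
  where
  α = P ++ ρ
  ℓ = length P

  packed-minimal : IsMinimal (Lock α) (Lock (pack α))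
  packed-minimal = ↝-packed-minimal (↝-refl α)

  open SortedFrom (maxEntry α) (length α) (suc ℓ) (entry α) (s≤s z≤n)
    (λ s 1≤s s≤ℓ → entry-prefix-positive ρ P₊ s 1≤s (s≤s⁻¹ s≤ℓ))
    (entry-beyond-length α) (entry≤maxEntry α)
    (λ s s' → nonzero-entries-sorted-after P ρ (Linked⇒AllPairs ≤-trans ρ-sorted))

first-zero : ∀ α → All (0 <_) α ⊎ ∃[ P ] All (0 <_) P × α ≡ P ++ 0 ∷ afterFirstZero α
first-zero [] = inj₁ []
first-zero (zero ∷ α) = inj₂ ([] , [] , refl)
first-zero (suc x ∷ α) with first-zero α
... | inj₁ α₊ = inj₁ (s≤s z≤n ∷ α₊)
... | inj₂ (P , P₊ , α≡) = inj₂ (suc x ∷ P , s≤s z≤n ∷ P₊ , cong (suc x ∷_) α≡)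

afterFirstZero-positive : ∀ {α} → All (0 <_) α → afterFirstZero α ≡ []
afterFirstZero-positive [] = refl
afterFirstZero-positive (s≤s _ ∷ α₊) = afterFirstZero-positive α₊

LockCondition⇒unique-minimal : ∀ α → LockCondition α → HasUniqueMinimal (Lock α)
LockCondition⇒unique-minimal α sorted with first-zero α
... | inj₁ α₊ = subst (HasUniqueMinimal ∘ Lock) (++-identityʳ α) (sorted-tail⇒unique-minimal α [] α₊ [])
... | inj₂ (P , P₊ , α≡) = subst (HasUniqueMinimal ∘ Lock) (sym α≡)
                             (sorted-tail⇒unique-minimal P (0 ∷ afterFirstZero α) P₊ sorted)

-- Descents: a second minimal element

record Descent (β : List ℕ) : Set where
  field
    before : List ℕ
    a k b : ℕ
    after : List ℕ
    b<a : b < a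
    β≡ : β ≡ before ++ suc a ∷ replicate k 0 ++ suc b ∷ after

nonzeros-++ : ∀ X Y → nonzeros (X ++ Y) ≡ nonzeros X ++ nonzeros Y
nonzeros-++ [] Y = refl
nonzeros-++ (zero ∷ X) Y = nonzeros-++ X Y
nonzeros-++ (suc x ∷ X) Y = cong (suc x ∷_) (nonzeros-++ X Y)

nonzeros-zeros : ∀ k Y → nonzeros (replicate k 0 ++ Y) ≡ nonzeros Y
nonzeros-zeros zero Y = refl
nonzeros-zeros (suc k) Y = nonzeros-zeros k Y

nonzeros-replicate : ∀ k → nonzeros (replicate k 0) ≡ []
nonzeros-replicate zero = refl
nonzeros-replicate (suc k) = nonzeros-replicate k

next-nonzero : ∀ β → (∃[ k ] β ≡ replicate k 0) ⊎ (∃[ k ] ∃[ w ] ∃[ T ] β ≡ replicate k 0 ++ suc w ∷ T)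
next-nonzero [] = inj₁ (0 , refl)
next-nonzero (suc w ∷ T) = inj₂ (0 , w , T , refl)
next-nonzero (zero ∷ β) with next-nonzero β
... | inj₁ (k , refl) = inj₁ (suc k , refl)
... | inj₂ (k , w , T , refl) = inj₂ (suc k , w , T , refl)

Descent-∷ : ∀ x {β} → Descent β → Descent (x ∷ β)
Descent-∷ x d = record { Descent d ; before = x ∷ before ; β≡ = cong (x ∷_) β≡ }
  where open Descent d

unsorted⇒descent : ∀ β → ¬ Linked _≤_ (nonzeros β) → Descent β
unsorted⇒descent [] unsorted = contradiction [] unsorted
unsorted⇒descent (zero ∷ β) unsorted = Descent-∷ 0 (unsorted⇒descent β unsorted)
unsorted⇒descent (suc x ∷ β) unsorted with next-nonzero β
... | inj₁ (k , refl) = contradiction (subst (Linked _≤_ ∘ (suc x ∷_)) (sym (nonzeros-replicate k)) [-]) unsorted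
... | inj₂ (k , w , T , β≡) with suc x ≤? suc w
...   | no x≰w = record { before = [] ; a = x ; k = k ; b = w ; after = T ; b<a = s≤s⁻¹ (≰⇒> x≰w)
                        ; β≡ = cong (suc x ∷_) β≡ }
...   | yes x≤w = Descent-∷ (suc x) (unsorted⇒descent β λ sorted →
          unsorted (subst (Linked _≤_ ∘ (suc x ∷_)) (sym nonzeros≡) (x≤w ∷ subst (Linked _≤_) nonzeros≡ sorted)))
  where
  nonzeros≡ : nonzeros β ≡ suc w ∷ nonzeros T
  nonzeros≡ = trans (cong nonzeros β≡) (nonzeros-zeros k (suc w ∷ T))

lock-row-length-≤ : ∀ {m} f g {s} → 1 ≤ s → f s ≤ m →
  (∀ c → lockDiagram m f s c ≡ true → lockDiagram m g s c ≡ true) → f s ≤ g s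
lock-row-length-≤ {m} f g {s} 1≤s fs≤m f⊆g = ≮⇒≥ λ gs<fs →
  let c = m ∸ g s
      c+gs≡m = m∸n+n≡m (<⇒≤ (<-≤-trans gs<fs fs≤m))
      f-cell = lock-intro f (1≤s , m<n⇒0<n∸m (<-≤-trans gs<fs fs≤m) , m∸n≤m m (g s) ,
                             subst (_< c + f s) c+gs≡m (+-monoʳ-< c gs<fs))
      _ , _ , _ , m<c+gs = lock-elim g s c (f⊆g c f-cell)
  in n≮n m (subst (m <_) c+gs≡m m<c+gs)

lock-≐⇒entry≡ : ∀ {γ γ'} → maxEntry γ ≡ maxEntry γ' → Lock γ ≐ Lock γ' → ∀ s → 1 ≤ s → entry γ s ≡ entry γ' s
lock-≐⇒entry≡ {γ} {γ'} width≡ locks≡ s 1≤s = ≤-antisym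
  (lock-row-length-≤ (entry γ) (entry γ') 1≤s (entry≤maxEntry γ s) (λ c cell → trans (sym (locks≡′ s c)) cell))
  (lock-row-length-≤ (entry γ') (entry γ) 1≤s (subst (entry γ' s ≤_) (sym width≡) (entry≤maxEntry γ' s))
     (λ c cell → trans (locks≡′ s c) cell))
  where
  locks≡′ : lockDiagram (maxEntry γ) (entry γ) ≐ lockDiagram (maxEntry γ) (entry γ')
  locks≡′ = subst (λ w → Lock γ ≐ lockDiagram w (entry γ')) (sym width≡) locks≡

entry-after : ∀ X x Y → entry (X ++ x ∷ Y) (suc (length X)) ≡ x
entry-after [] x Y = refl
entry-after (_ ∷ X) x Y = entry-after X x Y

entry-pack : ∀ α X x Y → nonzeros α ≡ X ++ x ∷ Y → entry (pack α) (suc (length X)) ≡ x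
entry-pack α X x Y nonzeros≡ rewrite nonzeros≡ | ++-assoc X (x ∷ Y) (zerosOf α) = entry-after X x (Y ++ zerosOf α)

-- Packing α directly puts suc a at position p = 1 + #(nonzeros of P ++ Q); first moving
-- suc b down next to suc a and then below it puts suc b there instead.
descent⇒not-unique : ∀ P Q a k b T → b < a →
  ¬ HasUniqueMinimal (Lock (P ++ 0 ∷ Q ++ suc a ∷ replicate k 0 ++ suc b ∷ T))
descent⇒not-unique P Q a k b T b<a (_ , _ , unique) =
  <-irrefl (suc-injective (begin
    suc b                    ≡⟨ sym (entry-pack γ prefix (suc b) (suc a ∷ nonzeros T) nonzeros-γ) ⟩
    entry (pack γ) p         ≡⟨ sym (lock-≐⇒entry≡ widths (≐-trans (unique _ packed-α) (≐-sym (unique _ packed-γ))) p (s≤s z≤n)) ⟩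
    entry (pack α) p         ≡⟨ entry-pack α prefix (suc a) (suc b ∷ nonzeros T) nonzeros-α ⟩
    suc a                    ∎)) b<a
  where
  open ≡-Reasoning
  Z = replicate k 0
  α = P ++ 0 ∷ Q ++ suc a ∷ Z ++ suc b ∷ T
  γ = (P ++ Q) ++ suc b ∷ suc a ∷ 0 ∷ Z ++ T
  prefix = nonzeros P ++ nonzeros Q
  p = suc (length prefix)

  α↝γ : α ↝ γ
  α↝γ = ↝-trans (subst₂ _↝_ (X-shape (Z ++ suc b ∷ T)) (X-shape (suc b ∷ Z ++ T)) (↝-sink-through-zeros X k (suc b) T))
       (↝-trans (↝-sink-block P Q (suc a ∷ suc b ∷ Z ++ T))
                (subst₂ _↝_ (++-assoc P Q _) refl (↝-sink-past (P ++ Q) (suc a) (suc b) (Z ++ T) (s≤s (<⇒≤ b<a)))))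
    where
    X = P ++ 0 ∷ Q ++ [ suc a ]
    X-shape : ∀ Y → X ++ Y ≡ P ++ 0 ∷ Q ++ suc a ∷ Y
    X-shape Y = trans (++-assoc P _ Y) (cong (λ R → P ++ 0 ∷ R) (++-assoc Q [ suc a ] Y))

  packed-α = ↝-packed-minimal (↝-refl α)
  packed-γ = ↝-packed-minimal α↝γ

  widths : maxEntry (pack α) ≡ maxEntry (pack γ)
  widths = trans (sym (proj₁ (↝-pack [] α))) (trans (proj₁ α↝γ) (proj₁ (↝-pack [] γ)))

  nonzeros-α : nonzeros α ≡ prefix ++ suc a ∷ suc b ∷ nonzeros T
  nonzeros-α = begin
    nonzeros α                                                             ≡⟨ nonzeros-++ P _ ⟩
    nonzeros P ++ nonzeros (Q ++ suc a ∷ Z ++ suc b ∷ T)                   ≡⟨ cong (nonzeros P ++_) (nonzeros-++ Q _) ⟩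
    nonzeros P ++ nonzeros Q ++ suc a ∷ nonzeros (Z ++ suc b ∷ T)          ≡⟨ cong (λ R → nonzeros P ++ nonzeros Q ++ suc a ∷ R) (nonzeros-zeros k _) ⟩
    nonzeros P ++ nonzeros Q ++ suc a ∷ suc b ∷ nonzeros T                 ≡⟨ sym (++-assoc (nonzeros P) _ _) ⟩
    prefix ++ suc a ∷ suc b ∷ nonzeros T                                   ∎

  nonzeros-γ : nonzeros γ ≡ prefix ++ suc b ∷ suc a ∷ nonzeros T
  nonzeros-γ = begin
    nonzeros γ                                                             ≡⟨ nonzeros-++ (P ++ Q) _ ⟩
    nonzeros (P ++ Q) ++ suc b ∷ suc a ∷ nonzeros (Z ++ T)                 ≡⟨ cong₂ (λ R S → R ++ suc b ∷ suc a ∷ S) (nonzeros-++ P Q) (nonzeros-zeros k T) ⟩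
    prefix ++ suc b ∷ suc a ∷ nonzeros T                                   ∎

unique-minimal⇒LockCondition : ∀ α → HasUniqueMinimal (Lock α) → LockCondition α
unique-minimal⇒LockCondition α unique with linked? _≤?_ (nonzeros (afterFirstZero α))
... | yes sorted = sorted
... | no unsorted with first-zero α
...   | inj₁ α₊ = contradiction (subst (Linked _≤_ ∘ nonzeros) (sym (afterFirstZero-positive α₊)) []) unsorted
...   | inj₂ (P , _ , α≡) = ⊥-elim $ descent⇒not-unique P before a k b after b<a
          (subst (HasUniqueMinimal ∘ Lock) (trans α≡ (cong (λ β → P ++ 0 ∷ β) β≡)) unique)
  where open Descent (unsorted⇒descent (afterFirstZero α) unsorted)

corollary6p4 : (α : List ℕ) → HasUniqueMinimal (Lock α) ⇔ LockCondition α
corollary6p4 α = mk⇔ (unique-minimal⇒LockCondition α) (LockCondition⇒unique-minimal α)
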